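{- For every $n\ge1$ and every permutation $\pi\in\mathfrak S_n$: (1) $\mathrm{maj}\,\pi=((a-cb)+(b-ac)+(c-ba)+(b-a])\,\pi$; (2) if $s_1s_2\cdots s_n=\Delta(L(\pi))$ is the McMahon code of $\pi$, then $((a-cb)+(b-ac)+(c-ba))\,\pi=\sum_{i=1}^{n-1}s_i$.
   Context: $\mathfrak S_n$ is the set of permutations $\pi=\pi_1\cdots\pi_n$ of $\{1,\dots,n\}$; $\mathrm{maj}\,\pi=\sum_{1\le i<n,\ \pi_i>\pi_{i+1}} i$. Vincular patterns are words over letters $a<b<c$ possibly containing dashes and a leading "[" or trailing "]". An occurrence of a pattern $p=p_1\cdots p_k$ (letters, ignoring dashes and brackets) in $\pi$ is a sequence of positions $i_1<\dots<i_k$ such that $\pi_{i_1}\cdots\pi_{i_k}$ is order-isomorphic to $p_1\cdots p_k$ (w.r.t. $a<b<c$), with $i_{r+1}=i_r+1$ whenever the $r$-th and $(r+1)$-st letters of the pattern are not separated by a dash, $i_1=1$ if the pattern begins with "[", and $i_k=n$ if it ends with "]". For patterns $\sigma,\tau,\dots$, $(\sigma+\tau+\cdots)\,\pi$ is the sum of their numbers of occurrences in $\pi$. E.g. $(a-cb)\,\pi=\#\{(i,j): i<j<n,\ \pi_i<\pi_{j+1}<\pi_j\}$, $(b-a])\,\pi=\#\{i<n:\pi_i>\pi_n\}$. The Lehmer code $L(\pi)=t_1\cdots t_n$ has $t_i=\#\{j<i:\pi_j>\pi_i\}$; it lies in $S_n$, the set of sequences with $0\le t_i\le i-1$. The map $\Delta:S_n\to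 S_n$ sends $t$ to $s$ with $s_i=(t_i-t_{i+1})\bmod i\in\{0,\dots,i-1\}$ for $1\le i<n$ and $s_n=t_n$. The McMahon code of $\pi$ is $\Delta(L(\pi))$. -}

module Defs where

open import Data.Nat using (ℕ; zero; suc; _+_; _*_; _<_; _<?_; _≤?_; NonZero)
open import Data.Nat.Properties using (≤-refl)
open import Data.Fin using (Fin; toℕ; fromℕ<)
open import Data.Fin.Permutation using (Permutation′; _⟨$⟩ʳ_)
open import Data.Integer using (+_; _-_)
open import Data.Integer.DivMod using (_%ℕ_)
open import Data.List using (upTo; map)
open import Data.Nat.ListAction using (sum)
open import Data.Bool using (if_then_else_)
open import Data.Product using (_×_)
open import Relation.Nullary using (Dec; does; yes; no)
open import Relation.Nullary.Decidable using (_×-dec_)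

[_] : ∀ {p} {P : Set p} → Dec P → ℕ
[ d ] = if does d then 1 else 0

Σ1 : ℕ → (ℕ → ℕ) → ℕ
Σ1 m f = sum (map (λ k → f (suc k)) (upTo m))

-- 1-indexed one-line notation: π ⟦ i ⟧ = π_i ∈ {1..n} for 1 ≤ i ≤ n (0 outside)
_⟦_⟧ : ∀ {n} → Permutation′ n → ℕ → ℕ
_⟦_⟧ {n} π zero = 0
_⟦_⟧ {n} π (suc k) with suc k Data.Nat.≤? n
... | yes k<n = suc (toℕ (π ⟨$⟩ʳ fromℕ< k<n))
... | no _ = 0

maj : ∀ {n} → Permutation′ n → ℕ
maj {n} π = Σ1 n λ i → [ i <? n ] * [ π ⟦ suc i ⟧ <? π ⟦ i ⟧ ] * i

pat-a-cb : ∀ {n} → Permutation′ n → ℕ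
pat-a-cb {n} π = Σ1 n λ i → Σ1 n λ j →
  [ (i <? j) ×-dec (j <? n) ×-dec (π ⟦ i ⟧ <? π ⟦ suc j ⟧) ×-dec (π ⟦ suc j ⟧ <? π ⟦ j ⟧) ]

pat-b-ac : ∀ {n} → Permutation′ n → ℕ
pat-b-ac {n} π = Σ1 n λ i → Σ1 n λ j →
  [ (i <? j) ×-dec (j <? n) ×-dec (π ⟦ j ⟧ <? π ⟦ i ⟧) ×-dec (π ⟦ i ⟧ <? π ⟦ suc j ⟧) ]

pat-c-ba : ∀ {n} → Permutation′ n → ℕ
pat-c-ba {n} π = Σ1 n λ i → Σ1 n λ j →
  [ (i <? j) ×-dec (j <? n) ×-dec (π ⟦ suc j ⟧ <? π ⟦ j ⟧) ×-dec (π ⟦ j ⟧ <? π ⟦ i ⟧) ]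

pat-b-a] : ∀ {n} → Permutation′ n → ℕ
pat-b-a] {n} π = Σ1 n λ i → [ (i <? n) ×-dec (π ⟦ n ⟧ <? π ⟦ i ⟧) ]

lehmer : ∀ {n} → Permutation′ n → ℕ → ℕ
lehmer π i = Σ1 i λ j → [ (j <? i) ×-dec (π ⟦ i ⟧ <? π ⟦ j ⟧) ]

Δ : ℕ → (ℕ → ℕ) → ℕ → ℕ
Δ n t zero = 0
Δ n t (suc k) with suc k <? n
... | yes _ = ((+ t (suc k)) - (+ t (suc (suc k)))) %ℕ (suc k)
... | no _ = t n

mcmahon : ∀ {n} → Permutation′ n → ℕ → ℕ
mcmahon {n} π = Δ n (lehmer π)

-- Write t = L(π) and let A_j (occurrencesAt j) count the occurrences of a-cb, b-ac and c-ba
-- whose last two letters are π_j π_{j+1}. Comparing each π_i, i ≤ j, with π_j and π_{j+1} gives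
--   A_j + t_{j+1} = j·[π_j > π_{j+1}] + t_j      (1 ≤ j < n).
-- Summed over j this telescopes to maj π = Σ_j A_j + t_n, and t_n is (b-a]) π by definition.
-- Since 0 ≤ A_j < j, the same identity says that A_j is the residue of t_j − t_{j+1} mod j, i.e. s_j.
module Submission where

open import Defs
open import Data.Nat using (ℕ; _+_; _≥_; _∸_)
open import Data.Product using (_×_)
open import Data.Fin.Permutation using (Permutation′)
open import Relation.Binary.PropositionalEquality using (_≡_)

open import Data.Fin using (toℕ; fromℕ<)
open import Data.Fin.Permutation using (_⟨$⟩ʳ_)
open import Data.Fin.Properties using (toℕ-fromℕ<; toℕ-injective)
import Data.Integer as ℤ
open import Data.Integer using (-[1+_]; _⊖_)
open import Data.Integer.DivMod using (_%ℕ_)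
open import Data.Integer.Properties using (⊖-≥; ⊖-<; [+m]-[+n]≡m⊖n)
open import Data.List using (_∷_; []; _++_; map; upTo)
open import Data.List.Properties using (upTo-∷ʳ; map-++)
open import Data.Nat
open import Data.Nat.DivMod using (m<n⇒m%n≡m; n%n≡0)
open import Data.Nat.ListAction using (sum)
open import Data.Nat.ListAction.Properties using (sum-++)
open import Data.Nat.Properties
open import Algebra.Properties.CommutativeSemigroup +-commutativeSemigroup using (interchange; xy∙z≈xz∙y)
open import Data.Product using (_,_; proj₁)
open import Data.Sum using (inj₁; inj₂)
open import Function using (_∘_)
open import Function.Bundles using (Injection)
open import Function.Properties.Inverse using (↔⇒↣)
open import Relation.Binary.PropositionalEquality using (_≢_; refl; sym; trans; cong; cong₂; subst; module ≡-Reasoning)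
open import Relation.Nullary using (Dec; yes; no; ¬_; contradiction)
open import Relation.Nullary.Decidable using (_×-dec_)

open ≡-Reasoning

Σ1-snoc : ∀ m f → Σ1 (suc m) f ≡ Σ1 m f + f (suc m)
Σ1-snoc m f = begin
  sum (map g (upTo (suc m)))              ≡⟨ cong (sum ∘ map g) (upTo-∷ʳ m) ⟨
  sum (map g (upTo m ++ m ∷ []))          ≡⟨ cong sum (map-++ g (upTo m) (m ∷ [])) ⟩
  sum (map g (upTo m) ++ g m ∷ [])        ≡⟨ sum-++ (map g (upTo m)) (g m ∷ []) ⟩
  Σ1 m f + (f (suc m) + 0)                ≡⟨ cong (Σ1 m f +_) (+-identityʳ (f (suc m))) ⟩
  Σ1 m f + f (suc m)                      ∎
  where g = f ∘ suc

Σ1-last-zero : ∀ m f → f (suc m) ≡ 0 → Σ1 (suc m) f ≡ Σ1 m f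
Σ1-last-zero m f f[1+m]≡0 = begin
  Σ1 (suc m) f        ≡⟨ Σ1-snoc m f ⟩
  Σ1 m f + f (suc m)  ≡⟨ cong (Σ1 m f +_) f[1+m]≡0 ⟩
  Σ1 m f + 0          ≡⟨ +-identityʳ (Σ1 m f) ⟩
  Σ1 m f              ∎

Σ1-cong : ∀ m {f g} → (∀ k → 1 ≤ k → k ≤ m → f k ≡ g k) → Σ1 m f ≡ Σ1 m g
Σ1-cong zero    f≗g = refl
Σ1-cong (suc m) {f} {g} f≗g = begin
  Σ1 (suc m) f        ≡⟨ Σ1-snoc m f ⟩
  Σ1 m f + f (suc m)  ≡⟨ cong₂ _+_ (Σ1-cong m (λ k 1≤k k≤m → f≗g k 1≤k (m≤n⇒m≤1+n k≤m)))
                                   (f≗g (suc m) (s≤s z≤n) ≤-refl) ⟩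
  Σ1 m g + g (suc m)  ≡⟨ Σ1-snoc m g ⟨
  Σ1 (suc m) g        ∎

Σ1-mono-≤ : ∀ m {f g} → (∀ k → f k ≤ g k) → Σ1 m f ≤ Σ1 m g
Σ1-mono-≤ zero    f≤g = z≤n
Σ1-mono-≤ (suc m) {f} {g} f≤g rewrite Σ1-snoc m f | Σ1-snoc m g =
  +-mono-≤ (Σ1-mono-≤ m f≤g) (f≤g (suc m))

Σ1-+ : ∀ m f g → Σ1 m (λ k → f k + g k) ≡ Σ1 m f + Σ1 m g
Σ1-+ zero    f g = refl
Σ1-+ (suc m) f g = begin
  Σ1 (suc m) (λ k → f k + g k)                   ≡⟨ Σ1-snoc m (λ k → f k + g k) ⟩
  Σ1 m (λ k → f k + g k) + (f (suc m) + g (suc m)) ≡⟨ cong (_+ (f (suc m) + g (suc m))) (Σ1-+ m f g) ⟩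
  Σ1 m f + Σ1 m g + (f (suc m) + g (suc m))      ≡⟨ interchange (Σ1 m f) (Σ1 m g) _ _ ⟩
  Σ1 m f + f (suc m) + (Σ1 m g + g (suc m))      ≡⟨ cong₂ _+_ (Σ1-snoc m f) (Σ1-snoc m g) ⟨
  Σ1 (suc m) f + Σ1 (suc m) g                    ∎

Σ1-+₃ : ∀ m f g h → Σ1 m (λ k → f k + g k + h k) ≡ Σ1 m f + Σ1 m g + Σ1 m h
Σ1-+₃ m f g h = trans (Σ1-+ m (λ k → f k + g k) h) (cong (_+ Σ1 m h) (Σ1-+ m f g))

Σ1-*ˡ : ∀ m c f → Σ1 m (λ k → c * f k) ≡ c * Σ1 m f
Σ1-*ˡ zero    c f = sym (*-zeroʳ c)
Σ1-*ˡ (suc m) c f = begin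
  Σ1 (suc m) (λ k → c * f k)         ≡⟨ Σ1-snoc m (λ k → c * f k) ⟩
  Σ1 m (λ k → c * f k) + c * f (suc m) ≡⟨ cong (_+ c * f (suc m)) (Σ1-*ˡ m c f) ⟩
  c * Σ1 m f + c * f (suc m)         ≡⟨ *-distribˡ-+ c (Σ1 m f) (f (suc m)) ⟨
  c * (Σ1 m f + f (suc m))           ≡⟨ cong (c *_) (Σ1-snoc m f) ⟨
  c * Σ1 (suc m) f                   ∎

Σ1-const : ∀ m c → Σ1 m (λ _ → c) ≡ m * c
Σ1-const zero    c = refl
Σ1-const (suc m) c = begin
  Σ1 (suc m) (λ _ → c)  ≡⟨ Σ1-snoc m (λ _ → c) ⟩
  Σ1 m (λ _ → c) + c    ≡⟨ cong (_+ c) (Σ1-const m c) ⟩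
  m * c + c             ≡⟨ +-comm (m * c) c ⟩
  suc m * c             ∎

Σ1-comm : ∀ m n (f : ℕ → ℕ → ℕ) → Σ1 m (λ i → Σ1 n (f i)) ≡ Σ1 n (λ j → Σ1 m (λ i → f i j))
Σ1-comm zero    n f = begin
  0                     ≡⟨ *-zeroʳ n ⟨
  n * 0                 ≡⟨ Σ1-const n 0 ⟨
  Σ1 n (λ _ → 0)        ∎
Σ1-comm (suc m) n f = begin
  Σ1 (suc m) (λ i → Σ1 n (f i))                             ≡⟨ Σ1-snoc m (λ i → Σ1 n (f i)) ⟩
  Σ1 m (λ i → Σ1 n (f i)) + Σ1 n (f (suc m))                ≡⟨ cong (_+ Σ1 n (f (suc m))) (Σ1-comm m n f) ⟩
  Σ1 n (λ j → Σ1 m (λ i → f i j)) + Σ1 n (f (suc m))        ≡⟨ Σ1-+ n (λ j → Σ1 m (λ i → f i j)) (f (suc m)) ⟨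
  Σ1 n (λ j → Σ1 m (λ i → f i j) + f (suc m) j)             ≡⟨ Σ1-cong n (λ j _ _ → Σ1-snoc m (λ i → f i j)) ⟨
  Σ1 n (λ j → Σ1 (suc m) (λ i → f i j))                     ∎

Σ1-truncate : ∀ {m n f} → m ≤ n → (∀ k → m < k → f k ≡ 0) → Σ1 n f ≡ Σ1 m f
Σ1-truncate {n = zero}  z≤n      _     = refl
Σ1-truncate {m} {suc n} {f} m≤1+n f>m≡0 with m≤n⇒m<n∨m≡n m≤1+n
... | inj₂ refl = refl
... | inj₁ (s≤s m≤n) = begin
  Σ1 (suc n) f  ≡⟨ Σ1-last-zero n f (f>m≡0 (suc n) (s≤s m≤n)) ⟩
  Σ1 n f        ≡⟨ Σ1-truncate {f = f} m≤n f>m≡0 ⟩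
  Σ1 m f        ∎

Σ1-telescope : ∀ m {f g} (t : ℕ → ℕ) → (∀ j → 1 ≤ j → j ≤ m → f j + t (suc j) ≡ g j + t j) →
  Σ1 m f + t (suc m) ≡ Σ1 m g + t 1
Σ1-telescope zero    t step = refl
Σ1-telescope (suc m) {f} {g} t step = begin
  Σ1 (suc m) f + t (suc (suc m))         ≡⟨ cong (_+ t (suc (suc m))) (Σ1-snoc m f) ⟩
  Σ1 m f + f (suc m) + t (suc (suc m))   ≡⟨ +-assoc (Σ1 m f) _ _ ⟩
  Σ1 m f + (f (suc m) + t (suc (suc m))) ≡⟨ cong (Σ1 m f +_) (step (suc m) (s≤s z≤n) ≤-refl) ⟩
  Σ1 m f + (g (suc m) + t (suc m))       ≡⟨ cong (Σ1 m f +_) (+-comm (g (suc m)) (t (suc m))) ⟩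
  Σ1 m f + (t (suc m) + g (suc m))       ≡⟨ +-assoc (Σ1 m f) _ _ ⟨
  Σ1 m f + t (suc m) + g (suc m)         ≡⟨ cong (_+ g (suc m)) (Σ1-telescope m {f} {g} t (λ j 1≤j j≤m → step j 1≤j (m≤n⇒m≤1+n j≤m))) ⟩
  Σ1 m g + t 1 + g (suc m)               ≡⟨ xy∙z≈xz∙y (Σ1 m g) (t 1) (g (suc m)) ⟩
  Σ1 m g + g (suc m) + t 1               ≡⟨ cong (_+ t 1) (Σ1-snoc m g) ⟨
  Σ1 (suc m) g + t 1                     ∎

[]≡1 : ∀ {p} {P : Set p} (P? : Dec P) → P → [ P? ] ≡ 1
[]≡1 (yes _) _  = refl
[]≡1 (no ¬p) p  = contradiction p ¬p

[]≡0 : ∀ {p} {P : Set p} (P? : Dec P) → ¬ P → [ P? ] ≡ 0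
[]≡0 (yes p) ¬p = contradiction p ¬p
[]≡0 (no _)  _  = refl

[]≤1 : ∀ {p} {P : Set p} (P? : Dec P) → [ P? ] ≤ 1
[]≤1 (yes _) = ≤-refl
[]≤1 (no _)  = z≤n

Σ1-[<1+] : ∀ {k n} → k ≤ n → Σ1 n (λ i → [ i <? suc k ]) ≡ k
Σ1-[<1+] {k} {n} k≤n = begin
  Σ1 n (λ i → [ i <? suc k ])  ≡⟨ Σ1-truncate k≤n (λ i k<i → []≡0 (i <? suc k) (<⇒≱ k<i ∘ s≤s⁻¹)) ⟩
  Σ1 k (λ i → [ i <? suc k ])  ≡⟨ Σ1-cong k (λ i _ i≤k → []≡1 (i <? suc k) (s≤s i≤k)) ⟩
  Σ1 k (λ _ → 1)               ≡⟨ Σ1-const k 1 ⟩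
  k * 1                        ≡⟨ *-identityʳ k ⟩
  k                            ∎

-- Here and in occurrenceᵈ the decisions are arguments: in a goal, `does (m <? n)` normalises
-- to `m <ᵇ n`, so a `with` on `m <? n` would find nothing to abstract.
cyclic-identity : ∀ {x y z : ℕ} → z ≢ y →
  (z<?y : Dec (z < y)) (y<?x : Dec (y < x)) (x<?z : Dec (x < z)) (y<?z : Dec (y < z)) →
  [ z<?y ×-dec y<?x ] + [ x<?z ×-dec z<?y ] + [ y<?x ×-dec x<?z ] + [ y<?z ] ≡ [ y<?x ] + [ x<?z ]
cyclic-identity _   (yes z<y) _         _         (yes y<z) = contradiction y<z (<-asym z<y)
cyclic-identity _   (yes z<y) (yes y<x) (yes x<z) (no _)    = contradiction (<-trans z<y (<-trans y<x x<z)) (<-irrefl refl)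
cyclic-identity _   (yes _)   (yes _)   (no _)    (no _)    = refl
cyclic-identity _   (yes _)   (no _)    (yes _)   (no _)    = refl
cyclic-identity _   (yes _)   (no _)    (no _)    (no _)    = refl
cyclic-identity z≢y (no z≮y)  _         _         (no y≮z)  = contradiction (≤-antisym (≮⇒≥ y≮z) (≮⇒≥ z≮y)) z≢y
cyclic-identity _   (no _)    (yes _)   (yes _)   (yes _)   = refl
cyclic-identity _   (no _)    (yes _)   (no _)    (yes _)   = refl
cyclic-identity _   (no _)    (no _)    (yes _)   (yes _)   = refl
cyclic-identity _   (no _)    (no y≮x)  (no x≮z)  (yes y<z) = contradiction (≤-trans (≮⇒≥ x≮z) (≮⇒≥ y≮x)) (<⇒≱ y<z)

cyclic-bound : ∀ {x y z : ℕ} (z<?y : Dec (z < y)) (y<?x : Dec (y < x)) (x<?z : Dec (x < z)) →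
  [ z<?y ×-dec y<?x ] + [ x<?z ×-dec z<?y ] + [ y<?x ×-dec x<?z ] ≤ 1
cyclic-bound (yes z<y) (yes y<x) (yes x<z) = contradiction (<-trans z<y (<-trans y<x x<z)) (<-irrefl refl)
cyclic-bound (yes _)   (yes _)   (no _)    = ≤-refl
cyclic-bound (yes _)   (no _)    (yes _)   = ≤-refl
cyclic-bound (yes _)   (no _)    (no _)    = z≤n
cyclic-bound (no _)    (yes _)   (yes _)   = ≤-refl
cyclic-bound (no _)    (yes _)   (no _)    = z≤n
cyclic-bound (no _)    (no _)    (yes _)   = z≤n
cyclic-bound (no _)    (no _)    (no _)    = z≤n

1*x*1≡x : ∀ x → 1 * x * 1 ≡ x
1*x*1≡x x = trans (*-identityʳ (1 * x)) (*-identityˡ x)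

-[1+]%ℕ : ∀ {r d k} → r + suc d ≡ suc k → -[1+ d ] %ℕ suc k ≡ r
-[1+]%ℕ {zero}  {d} refl rewrite n%n≡0 (suc d) {{_}} = refl
-[1+]%ℕ {suc r} {d} {k} r+1+d≡1+k
  rewrite m<n⇒m%n≡m (subst (suc d <_) r+1+d≡1+k (s≤s (m≤n+m (suc d) r))) = begin
  suc k ∸ suc d              ≡⟨ cong (_∸ suc d) r+1+d≡1+k ⟨
  suc r + suc d ∸ suc d      ≡⟨ m+n∸n≡m (suc r) (suc d) ⟩
  suc r                      ∎

%ℕ-of-difference : ∀ {r a b k} δ → δ ≤ 1 → r < suc k → r + b ≡ δ * suc k + a → (ℤ.+ a ℤ.- ℤ.+ b) %ℕ suc k ≡ r
%ℕ-of-difference {r} {a} {b} {k} 0 _ r<1+k r+b≡a = begin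
  (ℤ.+ a ℤ.- ℤ.+ b) %ℕ suc k  ≡⟨ cong (_%ℕ suc k) ([+m]-[+n]≡m⊖n a b) ⟩
  (a ⊖ b) %ℕ suc k            ≡⟨ cong (_%ℕ suc k) (⊖-≥ (subst (b ≤_) r+b≡a (m≤n+m b r))) ⟩
  (a ∸ b) % suc k             ≡⟨ cong (λ a → (a ∸ b) % suc k) r+b≡a ⟨
  (r + b ∸ b) % suc k         ≡⟨ cong (_% suc k) (m+n∸n≡m r b) ⟩
  r % suc k                   ≡⟨ m<n⇒m%n≡m r<1+k ⟩
  r                           ∎
%ℕ-of-difference {r} {a} {b} {k} 1 _ r<1+k r+b≡1+k+a = begin
  (ℤ.+ a ℤ.- ℤ.+ b) %ℕ suc k  ≡⟨ cong (_%ℕ suc k) ([+m]-[+n]≡m⊖n a b) ⟩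
  (a ⊖ b) %ℕ suc k            ≡⟨ cong (_%ℕ suc k) (⊖-< (subst (a <_) (sym b≡1+d+a) (m<n+m a z<s))) ⟩
  (ℤ.- ℤ.+ (b ∸ a)) %ℕ suc k  ≡⟨ cong (λ c → ℤ.- ℤ.+ c %ℕ suc k) (trans (cong (_∸ a) b≡1+d+a) (m+n∸n≡m (suc d) a)) ⟩
  -[1+ d ] %ℕ suc k           ≡⟨ -[1+]%ℕ r+1+d≡1+k ⟩
  r                           ∎
  where
  d = k ∸ r
  r+1+d≡1+k : r + suc d ≡ suc k
  r+1+d≡1+k = trans (+-suc r d) (cong suc (m+[n∸m]≡n (s≤s⁻¹ r<1+k)))
  b≡1+d+a : b ≡ suc d + a
  b≡1+d+a = +-cancelˡ-≡ r b _ (begin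
    r + b              ≡⟨ r+b≡1+k+a ⟩
    1 * suc k + a      ≡⟨ cong (_+ a) (*-identityˡ (suc k)) ⟩
    suc k + a          ≡⟨ cong (_+ a) r+1+d≡1+k ⟨
    r + suc d + a      ≡⟨ +-assoc r (suc d) a ⟩
    r + (suc d + a)    ∎)
%ℕ-of-difference (2+ _) (s≤s ()) _ _

Δ-< : ∀ n t k → suc k < n → Δ n t (suc k) ≡ (ℤ.+ t (suc k) ℤ.- ℤ.+ t (suc (suc k))) %ℕ suc k
Δ-< n t k 1+k<n with suc k <? n
... | yes _     = refl
... | no 1+k≮n = contradiction 1+k<n 1+k≮n

⟦⟧-fromℕ< : ∀ {n} (π : Permutation′ n) {k} (1+k≤n : suc k ≤ n) → π ⟦ suc k ⟧ ≡ suc (toℕ (π ⟨$⟩ʳ fromℕ< 1+k≤n))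
⟦⟧-fromℕ< {n} π {k} 1+k≤n with suc k ≤? n
... | yes _     = refl
... | no 1+k≰n = contradiction 1+k≤n 1+k≰n

⟦⟧-injective : ∀ {n} (π : Permutation′ n) {i j} → suc i ≤ n → suc j ≤ n → π ⟦ suc i ⟧ ≡ π ⟦ suc j ⟧ → i ≡ j
⟦⟧-injective π {i} {j} 1+i≤n 1+j≤n πi≡πj = begin
  i                           ≡⟨ toℕ-fromℕ< 1+i≤n ⟨
  toℕ (fromℕ< 1+i≤n)          ≡⟨ cong toℕ (Injection.injective (↔⇒↣ π) π⟨i⟩≡π⟨j⟩) ⟩
  toℕ (fromℕ< 1+j≤n)          ≡⟨ toℕ-fromℕ< 1+j≤n ⟩
  j                           ∎
  where
  π⟨i⟩≡π⟨j⟩ : π ⟨$⟩ʳ fromℕ< 1+i≤n ≡ π ⟨$⟩ʳ fromℕ< 1+j≤n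
  π⟨i⟩≡π⟨j⟩ = toℕ-injective (suc-injective (trans (sym (⟦⟧-fromℕ< π 1+i≤n)) (trans πi≡πj (⟦⟧-fromℕ< π 1+j≤n))))

module _ {n} (π : Permutation′ n) where

  descent : ℕ → ℕ
  descent j = [ j <? n ] * [ π ⟦ suc j ⟧ <? π ⟦ j ⟧ ]

  inversion : ℕ → ℕ → ℕ
  inversion i k = [ (i <? k) ×-dec (π ⟦ k ⟧ <? π ⟦ i ⟧) ]

  occurrenceᵈ : ∀ {i j} → Dec (i < j) → Dec (j < n) → ℕ
  occurrenceᵈ {i} {j} i<?j j<?n =
      [ i<?j ×-dec j<?n ×-dec (π ⟦ i ⟧ <? π ⟦ suc j ⟧) ×-dec (π ⟦ suc j ⟧ <? π ⟦ j ⟧) ]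
    + [ i<?j ×-dec j<?n ×-dec (π ⟦ j ⟧ <? π ⟦ i ⟧) ×-dec (π ⟦ i ⟧ <? π ⟦ suc j ⟧) ]
    + [ i<?j ×-dec j<?n ×-dec (π ⟦ suc j ⟧ <? π ⟦ j ⟧) ×-dec (π ⟦ j ⟧ <? π ⟦ i ⟧) ]

  occurrence : ℕ → ℕ → ℕ
  occurrence i j = occurrenceᵈ (i <? j) (j <? n)

  occurrencesAt : ℕ → ℕ
  occurrencesAt j = Σ1 n (λ i → occurrence i j)

  inversion-vanishes : ∀ {i k} → k < i → inversion i k ≡ 0
  inversion-vanishes {i} {k} k<i = []≡0 ((i <? k) ×-dec (π ⟦ k ⟧ <? π ⟦ i ⟧)) (<-asym k<i ∘ proj₁)

  occurrenceᵈ+inversion : ∀ {i j} → 1 ≤ i → j < n →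
    (i<?j : Dec (i < j)) (j<?n : Dec (j < n)) (i<?1+j : Dec (i < suc j)) →
    occurrenceᵈ i<?j j<?n + [ i<?1+j ×-dec (π ⟦ suc j ⟧ <? π ⟦ i ⟧) ]
      ≡ [ j<?n ] * [ π ⟦ suc j ⟧ <? π ⟦ j ⟧ ] * [ i<?1+j ] + [ i<?j ×-dec (π ⟦ j ⟧ <? π ⟦ i ⟧) ]
  occurrenceᵈ+inversion {suc i} {j} _ j<n (yes i<j) (yes _) (yes _) = trans
    (cyclic-identity πi≢πj+1 (π ⟦ suc i ⟧ <? π ⟦ suc j ⟧) (π ⟦ suc j ⟧ <? π ⟦ j ⟧)
                             (π ⟦ j ⟧ <? π ⟦ suc i ⟧) (π ⟦ suc j ⟧ <? π ⟦ suc i ⟧))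
    (cong (_+ [ π ⟦ j ⟧ <? π ⟦ suc i ⟧ ]) (sym (1*x*1≡x [ π ⟦ suc j ⟧ <? π ⟦ j ⟧ ])))
    where
    πi≢πj+1 : π ⟦ suc i ⟧ ≢ π ⟦ suc j ⟧
    πi≢πj+1 = <⇒≢ (m<n⇒m<1+n i<j) ∘ cong suc ∘ ⟦⟧-injective π (<⇒≤ (<-trans i<j j<n)) j<n
  occurrenceᵈ+inversion {i} {j} _ j<n (no i≮j) (yes _) (yes i≤j) = begin
    [ π ⟦ suc j ⟧ <? π ⟦ i ⟧ ]                 ≡⟨ cong (λ k → [ π ⟦ suc j ⟧ <? π ⟦ k ⟧ ]) i≡j ⟩
    [ π ⟦ suc j ⟧ <? π ⟦ j ⟧ ]                 ≡⟨ 1*x*1≡x _ ⟨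
    1 * [ π ⟦ suc j ⟧ <? π ⟦ j ⟧ ] * 1         ≡⟨ +-identityʳ _ ⟨
    1 * [ π ⟦ suc j ⟧ <? π ⟦ j ⟧ ] * 1 + 0     ∎
    where
    i≡j : i ≡ j
    i≡j = ≤-antisym (s≤s⁻¹ i≤j) (≮⇒≥ i≮j)
  occurrenceᵈ+inversion {j = j} _ _ (no _) (yes _) (no _) =
    sym (cong (_+ 0) (*-zeroʳ (1 * [ π ⟦ suc j ⟧ <? π ⟦ j ⟧ ])))
  occurrenceᵈ+inversion _ _ (yes i<j) (yes _) (no i≮1+j) = contradiction (m<n⇒m<1+n i<j) i≮1+j
  occurrenceᵈ+inversion _ j<n _     (no j≮n) _           = contradiction j<n j≮n

  occurrence+inversion : ∀ {i j} → 1 ≤ i → j < n →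
    occurrence i j + inversion i (suc j) ≡ descent j * [ i <? suc j ] + inversion i j
  occurrence+inversion {i} {j} 1≤i j<n = occurrenceᵈ+inversion 1≤i j<n (i <? j) (j <? n) (i <? suc j)

  occurrenceᵈ≤[] : ∀ {i j} (i<?j : Dec (i < j)) (j<?n : Dec (j < n)) → occurrenceᵈ i<?j j<?n ≤ [ i<?j ]
  occurrenceᵈ≤[] {i} {j} (yes _) (yes _) =
    cyclic-bound (π ⟦ i ⟧ <? π ⟦ suc j ⟧) (π ⟦ suc j ⟧ <? π ⟦ j ⟧) (π ⟦ j ⟧ <? π ⟦ i ⟧)
  occurrenceᵈ≤[] (yes _) (no _) = z≤n
  occurrenceᵈ≤[] (no _)  _      = z≤n

  occurrencesAt+lehmer : ∀ {j} → j < n → occurrencesAt j + lehmer π (suc j) ≡ descent j * j + lehmer π j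
  occurrencesAt+lehmer {j} j<n = begin
    occurrencesAt j + lehmer π (suc j)
      ≡⟨ cong (occurrencesAt j +_) (Σ1-truncate j<n (λ _ → inversion-vanishes)) ⟨
    occurrencesAt j + Σ1 n (λ i → inversion i (suc j))
      ≡⟨ Σ1-+ n (λ i → occurrence i j) (λ i → inversion i (suc j)) ⟨
    Σ1 n (λ i → occurrence i j + inversion i (suc j))
      ≡⟨ Σ1-cong n (λ i 1≤i _ → occurrence+inversion 1≤i j<n) ⟩
    Σ1 n (λ i → descent j * [ i <? suc j ] + inversion i j)
      ≡⟨ Σ1-+ n (λ i → descent j * [ i <? suc j ]) (λ i → inversion i j) ⟩
    Σ1 n (λ i → descent j * [ i <? suc j ]) + Σ1 n (λ i → inversion i j)
      ≡⟨ cong₂ _+_ (Σ1-*ˡ n (descent j) (λ i → [ i <? suc j ]))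
                   (Σ1-truncate (<⇒≤ j<n) (λ _ → inversion-vanishes)) ⟩
    descent j * Σ1 n (λ i → [ i <? suc j ]) + lehmer π j
      ≡⟨ cong (λ c → descent j * c + lehmer π j) (Σ1-[<1+] (<⇒≤ j<n)) ⟩
    descent j * j + lehmer π j ∎

  occurrencesAt[1+k]≤k : ∀ {k} → k ≤ n → occurrencesAt (suc k) ≤ k
  occurrencesAt[1+k]≤k {k} k≤n =
    ≤-trans (Σ1-mono-≤ n (λ i → occurrenceᵈ≤[] (i <? suc k) (suc k <? n))) (≤-reflexive (Σ1-[<1+] k≤n))

  occurrenceᵈ-≮ : ∀ {i j} (i<?j : Dec (i < j)) (j<?n : Dec (j < n)) → ¬ j < n → occurrenceᵈ i<?j j<?n ≡ 0
  occurrenceᵈ-≮ (no _)  _         _   = refl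
  occurrenceᵈ-≮ (yes _) (no _)    _   = refl
  occurrenceᵈ-≮ (yes _) (yes j<n) j≮n = contradiction j<n j≮n

  occurrencesAt-n≡0 : occurrencesAt n ≡ 0
  occurrencesAt-n≡0 = Σ1-truncate {n = n} z≤n (λ i _ → occurrenceᵈ-≮ (i <? n) (n <? n) (<-irrefl refl))

  patterns≡Σ1-occurrencesAt : pat-a-cb π + pat-b-ac π + pat-c-ba π ≡ Σ1 n occurrencesAt
  patterns≡Σ1-occurrencesAt = begin
    pat-a-cb π + pat-b-ac π + pat-c-ba π
      ≡⟨ cong (_+ pat-c-ba π) (Σ1-+ n (λ i → Σ1 n (a-cb i)) (λ i → Σ1 n (b-ac i))) ⟨
    Σ1 n (λ i → Σ1 n (a-cb i) + Σ1 n (b-ac i)) + pat-c-ba π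
      ≡⟨ Σ1-+ n (λ i → Σ1 n (a-cb i) + Σ1 n (b-ac i)) (λ i → Σ1 n (c-ba i)) ⟨
    Σ1 n (λ i → Σ1 n (a-cb i) + Σ1 n (b-ac i) + Σ1 n (c-ba i))
      ≡⟨ Σ1-cong n (λ i _ _ → Σ1-+₃ n (a-cb i) (b-ac i) (c-ba i)) ⟨
    Σ1 n (λ i → Σ1 n (occurrence i))
      ≡⟨ Σ1-comm n n occurrence ⟩
    Σ1 n occurrencesAt ∎
    where
    a-cb b-ac c-ba : ℕ → ℕ → ℕ
    a-cb i j = [ (i <? j) ×-dec (j <? n) ×-dec (π ⟦ i ⟧ <? π ⟦ suc j ⟧) ×-dec (π ⟦ suc j ⟧ <? π ⟦ j ⟧) ]
    b-ac i j = [ (i <? j) ×-dec (j <? n) ×-dec (π ⟦ j ⟧ <? π ⟦ i ⟧) ×-dec (π ⟦ i ⟧ <? π ⟦ suc j ⟧) ]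
    c-ba i j = [ (i <? j) ×-dec (j <? n) ×-dec (π ⟦ suc j ⟧ <? π ⟦ j ⟧) ×-dec (π ⟦ j ⟧ <? π ⟦ i ⟧) ]

  descent-n≡0 : descent n ≡ 0
  descent-n≡0 = cong (_* [ π ⟦ suc n ⟧ <? π ⟦ n ⟧ ]) ([]≡0 (n <? n) (<-irrefl refl))

  descent≤1 : ∀ j → descent j ≤ 1
  descent≤1 j = *-mono-≤ ([]≤1 (j <? n)) ([]≤1 (π ⟦ suc j ⟧ <? π ⟦ j ⟧))

  occurrencesAt≡mcmahon : ∀ {k} → suc k < n → occurrencesAt (suc k) ≡ mcmahon π (suc k)
  occurrencesAt≡mcmahon {k} 1+k<n = sym (begin
    mcmahon π (suc k)
      ≡⟨ Δ-< n (lehmer π) k 1+k<n ⟩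
    (ℤ.+ lehmer π (suc k) ℤ.- ℤ.+ lehmer π (suc (suc k))) %ℕ suc k
      ≡⟨ %ℕ-of-difference (descent (suc k)) (descent≤1 (suc k))
           (s≤s (occurrencesAt[1+k]≤k (<⇒≤ (<-trans (n<1+n k) 1+k<n)))) (occurrencesAt+lehmer 1+k<n) ⟩
    occurrencesAt (suc k) ∎)

corollary2 : (n : ℕ) → n ≥ 1 → (π : Permutation′ n) →
    (maj π ≡ pat-a-cb π + pat-b-ac π + pat-c-ba π + pat-b-a] π)
    × (pat-a-cb π + pat-b-ac π + pat-c-ba π ≡ Σ1 (n ∸ 1) (mcmahon π))
corollary2 (suc m) _ π = maj≡ , patterns≡Σ1-mcmahon
  where
  patterns≡Σ1-occurrencesAt′ : pat-a-cb π + pat-b-ac π + pat-c-ba π ≡ Σ1 m (occurrencesAt π)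
  patterns≡Σ1-occurrencesAt′ =
    trans (patterns≡Σ1-occurrencesAt π) (Σ1-last-zero m (occurrencesAt π) (occurrencesAt-n≡0 π))

  maj≡ : maj π ≡ pat-a-cb π + pat-b-ac π + pat-c-ba π + pat-b-a] π
  maj≡ = begin
    maj π
      ≡⟨ Σ1-last-zero m (λ j → descent π j * j) (cong (_* suc m) (descent-n≡0 π)) ⟩
    Σ1 m (λ j → descent π j * j)
      ≡⟨ +-identityʳ _ ⟨
    Σ1 m (λ j → descent π j * j) + lehmer π 1
      ≡⟨ Σ1-telescope m {occurrencesAt π} (lehmer π) (λ j _ j≤m → occurrencesAt+lehmer π (s≤s j≤m)) ⟨
    Σ1 m (occurrencesAt π) + lehmer π (suc m)
      ≡⟨ cong (_+ lehmer π (suc m)) patterns≡Σ1-occurrencesAt′ ⟨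
    pat-a-cb π + pat-b-ac π + pat-c-ba π + pat-b-a] π ∎

  patterns≡Σ1-mcmahon : pat-a-cb π + pat-b-ac π + pat-c-ba π ≡ Σ1 m (mcmahon π)
  patterns≡Σ1-mcmahon = trans patterns≡Σ1-occurrencesAt′
    (Σ1-cong m {occurrencesAt π} {mcmahon π} (λ { (suc k) _ 1+k≤m → occurrencesAt≡mcmahon π (s≤s 1+k≤m) }))
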